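{- Let $\sigma,\tau\in\mathfrak S_n$ with $\mathrm{LAC}\,\sigma=\mathrm{LAC}\,\tau$. Then (i) $\mathrm{Ligne}\,\sigma=\mathrm{Ligne}\,\tau$; (ii) $(\mathrm{des}\,\sigma,\mathrm{maj}\,\sigma)=(\mathrm{des}\,\tau,\mathrm{maj}\,\tau)$; (iii) $\mathrm{pix}\,\sigma=\mathrm{pix}\,\tau$; (iv) $\mathrm{lec}\,\sigma=\mathrm{lec}\,\tau$.
   Context: $\mathrm{Ligne}\,\sigma=\{i:1\le i\le n-1,\ \sigma(i)>\sigma(i+1)\}$, $\mathrm{des}\,\sigma=\#\mathrm{Ligne}\,\sigma$, $\mathrm{maj}\,\sigma=\sum_{i\in\mathrm{Ligne}\,\sigma}i$. With $\sigma(n+1)=+\infty$, for $1\le i\le n$ let $\ell_i=0$ if $\sigma(i)<\sigma(i+1)$, and $\ell_i=k$ if $\sigma(i)$ exceeds all of $\sigma(i+1),\dots,\sigma(i+k)$ but $\sigma(i)<\sigma(i+k+1)$; $\mathrm{LAC}\,\sigma=\ell_1\cdots\ell_n$. A hook is a word $x_1\cdots x_m$ of distinct positive integers with $m\ge 2$, $x_1>x_2$, and either $m=2$ or $x_2<\cdots<x_m$. Each $\sigma$ has a unique hook factorization $p\,\tau_1\cdots\tau_k$ with $p$ increasing (possibly empty) and each $\tau_i$ a hook; $\mathrm{pix}\,\sigma$ is the length of $p$ and $\mathrm{lec}\,\sigma=\sum_i\mathrm{inv}\,\tau_i$, where $\mathrm{inv}$ counts pairs of positions $a<b$ with $x_a>x_b$.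 -}

module Defs where

open import Data.Nat using (ℕ; zero; suc; _+_; _<_; _<?_)
open import Data.Fin using (Fin; toℕ)
open import Data.Fin.Permutation using (Permutation′; _⟨$⟩ʳ_)
open import Data.Nat.ListAction using (sum)
open import Data.List using (List; []; _∷_; _++_; length; tabulate; takeWhile; filter; concat; map)
open import Data.List.Relation.Unary.All using (All)
open import Data.List.Relation.Unary.Linked using (Linked)
open import Data.Product using (_×_)
open import Data.Empty using (⊥)
open import Relation.Nullary using (yes; no)
open import Relation.Binary.PropositionalEquality using (_≡_)

word : ∀ {n} → Permutation′ n → List ℕ
word σ = tabulate (λ i → suc (toℕ (σ ⟨$⟩ʳ i)))

-- Positions are 1-based; k is the position of the head.
-- ligneFrom k x ys: descents of the word x ∷ ys whose head sits at position k.
ligneFrom : ℕ → ℕ → List ℕ → List ℕ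
ligneFrom k x []       = []
ligneFrom k x (y ∷ ys) with y <? x
... | yes _ = k ∷ ligneFrom (suc k) y ys
... | no  _ = ligneFrom (suc k) y ys

ligneW : List ℕ → List ℕ
ligneW []       = []
ligneW (x ∷ xs) = ligneFrom 1 x xs

Ligne : ∀ {n} → Permutation′ n → List ℕ
Ligne σ = ligneW (word σ)

des : ∀ {n} → Permutation′ n → ℕ
des σ = length (Ligne σ)

maj : ∀ {n} → Permutation′ n → ℕ
maj σ = sum (Ligne σ)

-- LAC: ℓ_i = number k of consecutive letters right after position i that
-- are all smaller than w(i) (with the sentinel w(n+1) = +∞).
lacW : List ℕ → List ℕ
lacW []       = []
lacW (x ∷ xs) = length (takeWhile (λ y → y <? x) xs) ∷ lacW xs

LAC : ∀ {n} → Permutation′ n → List ℕ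
LAC σ = lacW (word σ)

Increasing : List ℕ → Set
Increasing = Linked _<_

IsHook : List ℕ → Set
IsHook []             = ⊥
IsHook (x ∷ [])       = ⊥
IsHook (x₁ ∷ x₂ ∷ xs) = (x₂ < x₁) × Increasing (x₂ ∷ xs)

-- A hook factorization w = p τ₁ ⋯ τ_k (unique for words of distinct letters).
HookFactorization : List ℕ → List ℕ → List (List ℕ) → Set
HookFactorization w p τs = (w ≡ p ++ concat τs) × Increasing p × All IsHook τs

inv : List ℕ → ℕ
inv []       = 0
inv (x ∷ xs) = length (filter (λ y → y <? x) xs) + inv xs

pixOf : List ℕ → ℕ
pixOf p = length p

lecOf : List (List ℕ) → ℕ
lecOf τs = sum (map inv τs)

-- The entry ℓᵢ of LAC is nonzero exactly at a descent, which gives Ligne, des and maj.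
-- In a hook factorization p τ₁ ⋯ τₖ the last hook τₖ = x₁ x₂ ⋯ xₘ has LAC
-- inv τₖ, 0, …, 0 with inv τₖ > 0, since x₂ < ⋯ < xₘ; so τₖ starts at the last
-- nonzero entry of LAC, and that entry is inv τₖ. Capping the earlier entries by
-- the distance to the start of τₖ recovers the LAC of p τ₁ ⋯ τₖ₋₁, and induction
-- on k ends with an increasing word p, whose LAC vanishes and has length pix.
module Submission where

open import Defs
open import Data.Nat using (ℕ; zero; suc; pred; _+_; _<_; _<?_; _⊓_)
open import Data.Nat.Properties using (<-trans; <⇒≯; ⊓-zeroʳ; +-identityʳ; 1+n≢0)
open import Data.Nat.ListAction using (sum)
open import Data.Nat.ListAction.Properties using (sum-++)
open import Data.List
  using (List; []; _∷_; _++_; _∷ʳ_; [_]; length; takeWhile; filter; concat; map; replicate)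
open import Data.List.Properties
  using (++-assoc; ++-identityʳ; concat-++; map-++; ∷-injective; filter-accept; filter-reject; filter-none)
open import Data.List.Relation.Unary.All using (All; []; _∷_)
import Data.List.Relation.Unary.All as All
open import Data.List.Relation.Unary.All.Properties using (++⁻)
open import Data.List.Relation.Unary.Linked using (_∷_)
import Data.List.Relation.Unary.Linked as Linked
open import Data.List.Relation.Unary.Linked.Properties using (Linked⇒All)
open import Data.List.Reverse using (Reverse; []; _∶_∶ʳ_; reverseView)
open import Data.Fin.Permutation using (Permutation′)
open import Data.Product using (_×_; _,_; proj₁; proj₂)
open import Data.Bool using (true; false)
open import Data.Empty using (⊥-elim)
open import Relation.Nullary using (yes; no; ¬_; does)
open import Relation.Unary using (Pred; Decidable)
open import Relation.Binary.PropositionalEquality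
  using (_≡_; _≢_; refl; sym; trans; cong; cong₂; subst; module ≡-Reasoning)

open ≡-Reasoning

module _ {a p} {A : Set a} {P : Pred A p} (P? : Decidable P) where

  takeWhile-accept : ∀ {x xs} → P x → takeWhile P? (x ∷ xs) ≡ x ∷ takeWhile P? xs
  takeWhile-accept {x} Px with P? x
  ... | yes _  = refl
  ... | no ¬Px = ⊥-elim (¬Px Px)

  takeWhile-reject : ∀ {x xs} → ¬ P x → takeWhile P? (x ∷ xs) ≡ []
  takeWhile-reject {x} ¬Px with P? x
  ... | yes Px = ⊥-elim (¬Px Px)
  ... | no _   = refl

  length-takeWhile-++-⊓ : ∀ xs ys →
    length (takeWhile P? (xs ++ ys)) ⊓ length xs ≡ length (takeWhile P? xs)
  length-takeWhile-++-⊓ []       ys = ⊓-zeroʳ _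
  length-takeWhile-++-⊓ (x ∷ xs) ys with does (P? x)
  ... | true  = cong suc (length-takeWhile-++-⊓ xs ys)
  ... | false = refl

Increasing⇒All< : ∀ {x xs} → Increasing (x ∷ xs) → All (x <_) xs
Increasing⇒All< {xs = []}    _           = []
Increasing⇒All< {xs = _ ∷ _} (x<y ∷ inc) = Linked⇒All <-trans x<y inc

takeWhile-<-increasing : ∀ {x xs} → Increasing (x ∷ xs) → takeWhile (_<? x) xs ≡ []
takeWhile-<-increasing {xs = []}    _         = refl
takeWhile-<-increasing {xs = _ ∷ _} (x<y ∷ _) = takeWhile-reject (_<? _) (<⇒≯ x<y)

filter≡takeWhile-increasing : ∀ x ys → Increasing ys → filter (_<? x) ys ≡ takeWhile (_<? x) ys
filter≡takeWhile-increasing x []       _   = refl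
filter≡takeWhile-increasing x (y ∷ ys) inc with y <? x
... | yes y<x = begin
  filter (_<? x) (y ∷ ys)    ≡⟨ filter-accept (_<? x) y<x ⟩
  y ∷ filter (_<? x) ys      ≡⟨ cong (y ∷_) (filter≡takeWhile-increasing x ys (Linked.tail inc)) ⟩
  y ∷ takeWhile (_<? x) ys   ≡⟨ takeWhile-accept (_<? x) y<x ⟨
  takeWhile (_<? x) (y ∷ ys) ∎
... | no y≮x = begin
  filter (_<? x) (y ∷ ys)    ≡⟨ filter-reject (_<? x) y≮x ⟩
  filter (_<? x) ys          ≡⟨ filter-none (_<? x) (All.map (λ y<z z<x → y≮x (<-trans y<z z<x))
                                                             (Increasing⇒All< inc)) ⟩
  []                         ≡⟨ takeWhile-reject (_<? x) y≮x ⟨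
  takeWhile (_<? x) (y ∷ ys) ∎

lacW-increasing : ∀ xs → Increasing xs → lacW xs ≡ replicate (length xs) 0
lacW-increasing []       _   = refl
lacW-increasing (x ∷ xs) inc =
  cong₂ _∷_ (cong length (takeWhile-<-increasing inc)) (lacW-increasing xs (Linked.tail inc))

inv-increasing : ∀ xs → Increasing xs → inv xs ≡ 0
inv-increasing []       _   = refl
inv-increasing (x ∷ xs) inc =
  cong₂ _+_ (cong length (filter-none (_<? x) (All.map <⇒≯ (Increasing⇒All< inc))))
            (inv-increasing xs (Linked.tail inc))

inv-hook : ∀ {x₁ x₂ xs} → IsHook (x₁ ∷ x₂ ∷ xs) →
  inv (x₁ ∷ x₂ ∷ xs) ≡ length (takeWhile (_<? x₁) (x₂ ∷ xs))
inv-hook {x₁} {x₂} {xs} (_ , inc) = begin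
  length (filter (_<? x₁) (x₂ ∷ xs)) + inv (x₂ ∷ xs)
    ≡⟨ cong₂ _+_ (cong length (filter≡takeWhile-increasing x₁ (x₂ ∷ xs) inc))
                 (inv-increasing (x₂ ∷ xs) inc) ⟩
  length (takeWhile (_<? x₁) (x₂ ∷ xs)) + 0
    ≡⟨ +-identityʳ _ ⟩
  length (takeWhile (_<? x₁) (x₂ ∷ xs)) ∎

inv-hook-nonzero : ∀ h → IsHook h → inv h ≢ 0
inv-hook-nonzero (x₁ ∷ x₂ ∷ xs) hook@(x₂<x₁ , _) =
  subst (_≢ 0) (sym (trans (inv-hook hook) (cong length (takeWhile-accept (_<? x₁) x₂<x₁)))) 1+n≢0

lacW-hook : ∀ h → IsHook h → lacW h ≡ inv h ∷ replicate (pred (length h)) 0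
lacW-hook (x₁ ∷ x₂ ∷ xs) hook@(_ , inc) =
  cong₂ _∷_ (sym (inv-hook hook)) (lacW-increasing (x₂ ∷ xs) inc)

zeros≢++nonzero∷ : ∀ {a R} r B → a ≢ 0 → replicate r 0 ≢ B ++ a ∷ R
zeros≢++nonzero∷ zero    []      _   ()
zeros≢++nonzero∷ zero    (_ ∷ _) _   ()
zeros≢++nonzero∷ (suc r) []      a≢0 eq = a≢0 (sym (proj₁ (∷-injective eq)))
zeros≢++nonzero∷ (suc r) (_ ∷ B) a≢0 eq = zeros≢++nonzero∷ r B a≢0 (proj₂ (∷-injective eq))

++-nonzero∷zeros-injective : ∀ {a b r s} A B → a ≢ 0 → b ≢ 0 →
  A ++ a ∷ replicate r 0 ≡ B ++ b ∷ replicate s 0 → A ≡ B × a ≡ b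
++-nonzero∷zeros-injective []      []      _   _   eq = refl , proj₁ (∷-injective eq)
++-nonzero∷zeros-injective []      (_ ∷ B) _   b≢0 eq =
  ⊥-elim (zeros≢++nonzero∷ _ B b≢0 (proj₂ (∷-injective eq)))
++-nonzero∷zeros-injective (_ ∷ A) []      a≢0 _   eq =
  ⊥-elim (zeros≢++nonzero∷ _ A a≢0 (sym (proj₂ (∷-injective eq))))
++-nonzero∷zeros-injective (_ ∷ A) (_ ∷ B) a≢0 b≢0 eq with ∷-injective eq
... | refl , eq′ with ++-nonzero∷zeros-injective A B a≢0 b≢0 eq′
... | refl , a≡b = refl , a≡b

lacPrefix : List ℕ → List ℕ → List ℕ
lacPrefix []       ys = []
lacPrefix (x ∷ xs) ys = length (takeWhile (_<? x) (xs ++ ys)) ∷ lacPrefix xs ys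

lacW-++ : ∀ xs ys → lacW (xs ++ ys) ≡ lacPrefix xs ys ++ lacW ys
lacW-++ []       ys = refl
lacW-++ (x ∷ xs) ys = cong (length (takeWhile (_<? x) (xs ++ ys)) ∷_) (lacW-++ xs ys)

length-lacPrefix : ∀ xs ys → length (lacPrefix xs ys) ≡ length xs
length-lacPrefix []       ys = refl
length-lacPrefix (x ∷ xs) ys = cong suc (length-lacPrefix xs ys)

length-lacW : ∀ xs → length (lacW xs) ≡ length xs
length-lacW []       = refl
length-lacW (x ∷ xs) = cong suc (length-lacW xs)

capLac : ℕ → List ℕ → List ℕ
capLac zero    _       = []
capLac (suc m) []      = []
capLac (suc m) (ℓ ∷ l) = ℓ ⊓ m ∷ capLac m l

capLac-lacW-++ : ∀ xs ys → capLac (length xs) (lacW (xs ++ ys)) ≡ lacW xs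
capLac-lacW-++ []       ys = refl
capLac-lacW-++ (x ∷ xs) ys =
  cong₂ _∷_ (length-takeWhile-++-⊓ (_<? x) xs ys) (capLac-lacW-++ xs ys)

lacW-++-hook : ∀ xs h → IsHook h →
  lacW (xs ++ h) ≡ lacPrefix xs h ++ inv h ∷ replicate (pred (length h)) 0
lacW-++-hook xs h hook = trans (lacW-++ xs h) (cong (lacPrefix xs h ++_) (lacW-hook h hook))

nonzeroPositions : ℕ → List ℕ → List ℕ
nonzeroPositions k []          = []
nonzeroPositions k (zero  ∷ l) = nonzeroPositions (suc k) l
nonzeroPositions k (suc _ ∷ l) = k ∷ nonzeroPositions (suc k) l

ligneFrom≡nonzeroPositions-lacW : ∀ k x ys → ligneFrom k x ys ≡ nonzeroPositions k (lacW (x ∷ ys))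
ligneFrom≡nonzeroPositions-lacW k x []       = refl
ligneFrom≡nonzeroPositions-lacW k x (y ∷ ys) with y <? x
... | yes y<x = begin
  k ∷ ligneFrom (suc k) y ys
    ≡⟨ cong (k ∷_) (ligneFrom≡nonzeroPositions-lacW (suc k) y ys) ⟩
  nonzeroPositions k (suc (length (takeWhile (_<? x) ys)) ∷ lacW (y ∷ ys))
    ≡⟨ cong (λ t → nonzeroPositions k (length t ∷ lacW (y ∷ ys))) (takeWhile-accept (_<? x) y<x) ⟨
  nonzeroPositions k (lacW (x ∷ y ∷ ys)) ∎
... | no y≮x = begin
  ligneFrom (suc k) y ys
    ≡⟨ ligneFrom≡nonzeroPositions-lacW (suc k) y ys ⟩
  nonzeroPositions k (0 ∷ lacW (y ∷ ys))
    ≡⟨ cong (λ t → nonzeroPositions k (length t ∷ lacW (y ∷ ys))) (takeWhile-reject (_<? x) y≮x) ⟨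
  nonzeroPositions k (lacW (x ∷ y ∷ ys)) ∎

ligneW≡nonzeroPositions-lacW : ∀ w → ligneW w ≡ nonzeroPositions 1 (lacW w)
ligneW≡nonzeroPositions-lacW []       = refl
ligneW≡nonzeroPositions-lacW (x ∷ xs) = ligneFrom≡nonzeroPositions-lacW 1 x xs

hookFactorization-[]⁻ : ∀ {w p} → HookFactorization w p [] → w ≡ p
hookFactorization-[]⁻ {p = p} (w≡p++[] , _) = trans w≡p++[] (++-identityʳ p)

hookFactorization-∷ʳ⁻ : ∀ {w p σs h} → HookFactorization w p (σs ∷ʳ h) →
  w ≡ (p ++ concat σs) ++ h × HookFactorization (p ++ concat σs) p σs × IsHook h
hookFactorization-∷ʳ⁻ {p = p} {σs} {h} (refl , inc , hooks) with ++⁻ σs hooks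
... | hooksσs , hook ∷ [] = w≡ , (refl , inc , hooksσs) , hook
  where
  w≡ : p ++ concat (σs ∷ʳ h) ≡ (p ++ concat σs) ++ h
  w≡ = begin
    p ++ concat (σs ∷ʳ h)        ≡⟨ cong (p ++_) (concat-++ σs [ h ]) ⟨
    p ++ (concat σs ++ h ++ [])  ≡⟨ cong (λ t → p ++ (concat σs ++ t)) (++-identityʳ h) ⟩
    p ++ (concat σs ++ h)        ≡⟨ ++-assoc p (concat σs) h ⟨
    (p ++ concat σs) ++ h        ∎

lecOf-∷ʳ : ∀ σs h → lecOf (σs ∷ʳ h) ≡ lecOf σs + inv h
lecOf-∷ʳ σs h = begin
  sum (map inv (σs ∷ʳ h))        ≡⟨ cong sum (map-++ inv σs [ h ]) ⟩
  sum (map inv σs ++ [ inv h ])  ≡⟨ sum-++ (map inv σs) [ inv h ] ⟩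
  lecOf σs + (inv h + 0)         ≡⟨ cong (lecOf σs +_) (+-identityʳ (inv h)) ⟩
  lecOf σs + inv h               ∎

lacW-hookless≢lacW-hooked : ∀ {u v p q τs h} → HookFactorization u p [] →
  HookFactorization v q (τs ∷ʳ h) → lacW u ≢ lacW v
lacW-hookless≢lacW-hooked {p = p} {q} {τs} {h} f g eq
  with hookFactorization-[]⁻ f | hookFactorization-∷ʳ⁻ g
... | refl | refl , _ , hook =
  zeros≢++nonzero∷ _ (lacPrefix (q ++ concat τs) h) (inv-hook-nonzero h hook) (begin
    replicate (length p) 0                            ≡⟨ lacW-increasing p (proj₁ (proj₂ f)) ⟨
    lacW p                                            ≡⟨ eq ⟩
    lacW ((q ++ concat τs) ++ h)                      ≡⟨ lacW-++-hook (q ++ concat τs) h hook ⟩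
    lacPrefix (q ++ concat τs) h ++ inv h ∷ replicate (pred (length h)) 0 ∎)

lacW-determines-pix-lec : ∀ {u v p q σs τs} → Reverse σs → Reverse τs →
  HookFactorization u p σs → HookFactorization v q τs → lacW u ≡ lacW v →
  pixOf p ≡ pixOf q × lecOf σs ≡ lecOf τs
lacW-determines-pix-lec {p = p} {q} [] [] f g eq with hookFactorization-[]⁻ f | hookFactorization-[]⁻ g
... | refl | refl = trans (sym (length-lacW p)) (trans (cong length eq) (length-lacW q)) , refl
lacW-determines-pix-lec [] (_ ∶ _ ∶ʳ _) f g eq = ⊥-elim (lacW-hookless≢lacW-hooked f g eq)
lacW-determines-pix-lec (_ ∶ _ ∶ʳ _) [] f g eq = ⊥-elim (lacW-hookless≢lacW-hooked g f (sym eq))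
lacW-determines-pix-lec {p = p} {q} (σs ∶ rσ ∶ʳ h) (τs ∶ rτ ∶ʳ h′) f g eq
  with hookFactorization-∷ʳ⁻ f | hookFactorization-∷ʳ⁻ g
... | refl , f′ , hook | refl , g′ , hook′ = proj₁ ih , lec≡
  where
  X = p ++ concat σs
  Y = q ++ concat τs

  split : lacPrefix X h ≡ lacPrefix Y h′ × inv h ≡ inv h′
  split = ++-nonzero∷zeros-injective _ _ (inv-hook-nonzero h hook) (inv-hook-nonzero h′ hook′)
            (trans (sym (lacW-++-hook X h hook)) (trans eq (lacW-++-hook Y h′ hook′)))

  |X|≡|Y| : length X ≡ length Y
  |X|≡|Y| = trans (sym (length-lacPrefix X h))
                  (trans (cong length (proj₁ split)) (length-lacPrefix Y h′))

  lacX≡lacY : lacW X ≡ lacW Y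
  lacX≡lacY = begin
    lacW X                               ≡⟨ capLac-lacW-++ X h ⟨
    capLac (length X) (lacW (X ++ h))    ≡⟨ cong₂ capLac |X|≡|Y| eq ⟩
    capLac (length Y) (lacW (Y ++ h′))   ≡⟨ capLac-lacW-++ Y h′ ⟩
    lacW Y                               ∎

  ih : pixOf p ≡ pixOf q × lecOf σs ≡ lecOf τs
  ih = lacW-determines-pix-lec rσ rτ f′ g′ lacX≡lacY

  lec≡ : lecOf (σs ∷ʳ h) ≡ lecOf (τs ∷ʳ h′)
  lec≡ = begin
    lecOf (σs ∷ʳ h)    ≡⟨ lecOf-∷ʳ σs h ⟩
    lecOf σs + inv h   ≡⟨ cong₂ _+_ (proj₂ ih) (proj₂ split) ⟩
    lecOf τs + inv h′  ≡⟨ lecOf-∷ʳ τs h′ ⟨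
    lecOf (τs ∷ʳ h′)   ∎

proposition7p3 : ∀ (n : ℕ) (σ τ : Permutation′ n) → LAC σ ≡ LAC τ →
      (Ligne σ ≡ Ligne τ)
    × ((des σ , maj σ) ≡ (des τ , maj τ))
    × (∀ (p q : List ℕ) (σs τs : List (List ℕ)) →
         HookFactorization (word σ) p σs → HookFactorization (word τ) q τs →
         pixOf p ≡ pixOf q)
    × (∀ (p q : List ℕ) (σs τs : List (List ℕ)) →
         HookFactorization (word σ) p σs → HookFactorization (word τ) q τs →
         lecOf σs ≡ lecOf τs)
proposition7p3 n σ τ lac≡ =
    ligne≡
  , cong (λ L → length L , sum L) ligne≡
  , (λ _ _ _ _ f g → proj₁ (pix-lec f g))
  , (λ _ _ _ _ f g → proj₂ (pix-lec f g))
  where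
  ligne≡ : Ligne σ ≡ Ligne τ
  ligne≡ = begin
    ligneW (word σ)            ≡⟨ ligneW≡nonzeroPositions-lacW (word σ) ⟩
    nonzeroPositions 1 (LAC σ) ≡⟨ cong (nonzeroPositions 1) lac≡ ⟩
    nonzeroPositions 1 (LAC τ) ≡⟨ ligneW≡nonzeroPositions-lacW (word τ) ⟨
    ligneW (word τ)            ∎

  pix-lec : ∀ {p q σs τs} → HookFactorization (word σ) p σs → HookFactorization (word τ) q τs →
    pixOf p ≡ pixOf q × lecOf σs ≡ lecOf τs
  pix-lec f g = lacW-determines-pix-lec (reverseView _) (reverseView _) f g lac≡
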